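{- Let $G$ be a $d$-regular graph on $n\ge 2$ vertices. Then $\lambda_{2,3}(G)\le \dfrac{d^3}{4(n-1)}$.
   Context: A path is alternating (with respect to an edge-coloring) if no two consecutive edges have the same color; the length of a path is its number of edges. For a graph $G$, $\lambda_{r,\ell}(G)$ is the maximum $t$ such that there is an $r$-coloring of the edges of $G$ in which every pair of distinct vertices is connected by at least $t$ alternating paths of length $\ell$ (the paths need not be internally disjoint). -}

module Defs where

open import Level using (0ℓ)
open import Data.Nat using (ℕ; _≤_)
open import Data.Fin using (Fin)
open import Data.Fin.Properties using () renaming (_≟_ to _≟F_)
open import Data.List using (List; length; filter; cartesianProduct; allFin)
open import Data.Product using (_×_; _,_; Σ)
open import Relation.Nullary using (¬_; Dec)
open import Relation.Nullary.Decidable using (_×-dec_; ¬?)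
open import Relation.Binary.PropositionalEquality using (_≡_; _≢_)

record SimpleGraph (n : ℕ) : Set₁ where
  field
    Adj     : Fin n → Fin n → Set
    adj?    : ∀ u v → Dec (Adj u v)
    symm    : ∀ {u v} → Adj u v → Adj v u
    irrefl  : ∀ {u} → ¬ Adj u u
open SimpleGraph public

degree : ∀ {n} → SimpleGraph n → Fin n → ℕ
degree G v = length (filter (adj? G v) (allFin _))

Regular : ∀ {n} → SimpleGraph n → ℕ → Set
Regular G d = ∀ v → degree G v ≡ d

-- An r-edge-colouring: a symmetric colour assignment to vertex pairs
-- (only its values on edges matter).
record EdgeColouring {n : ℕ} (G : SimpleGraph n) (r : ℕ) : Set where
  field
    col    : Fin n → Fin n → Fin r
    colSym : ∀ u v → col u v ≡ col v u
open EdgeColouring public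

-- (a , b) is the interior of an alternating path u - a - b - v of length 3:
-- vertices pairwise distinct, consecutive vertices adjacent, consecutive edges
-- of different colours.
AltPath3 : ∀ {n r} (G : SimpleGraph n) → EdgeColouring G r → Fin n → Fin n → Fin n × Fin n → Set
AltPath3 G c u v (a , b) =
  (u ≢ a) × (u ≢ b) × (u ≢ v) × (a ≢ b) × (a ≢ v) × (b ≢ v) ×
  Adj G u a × Adj G a b × Adj G b v ×
  (col c u a ≢ col c a b) × (col c a b ≢ col c b v)

altPath3? : ∀ {n r} (G : SimpleGraph n) (c : EdgeColouring G r) u v p → Dec (AltPath3 G c u v p)
altPath3? G c u v (a , b) =
  ¬? (u ≟F a) ×-dec ¬? (u ≟F b) ×-dec ¬? (u ≟F v) ×-dec ¬? (a ≟F b) ×-dec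
  ¬? (a ≟F v) ×-dec ¬? (b ≟F v) ×-dec
  adj? G u a ×-dec adj? G a b ×-dec adj? G b v ×-dec
  ¬? (col c u a ≟F col c a b) ×-dec ¬? (col c a b ≟F col c b v)

-- number of alternating paths of length 3 between u and v
-- (a path from u to v of length 3 is determined by its interior sequence (a , b))
numAltPaths3 : ∀ {n r} (G : SimpleGraph n) → EdgeColouring G r → Fin n → Fin n → ℕ
numAltPaths3 {n} G c u v =
  length (filter (altPath3? G c u v) (cartesianProduct (allFin n) (allFin n)))

-- t is achievable for λ_{r,3}: some r-colouring gives every pair of distinct
-- vertices at least t alternating paths of length 3.
-- λ_{r,3}(G) is the maximum such t.
Achievable23 : ∀ {n} → SimpleGraph n → ℕ → ℕ → Set
Achievable23 G r t = Σ (EdgeColouring G r) λ c → ∀ u v → u ≢ v → t ≤ numAltPaths3 G c u v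

module Submission where

-- Classify the alternating paths u–a–b–v by their middle edge ab. The end u must be a
-- neighbour of a joined in the colour opposite to that of ab, and likewise v at b, so ab
-- carries at most x(a,b)·x(b,a) paths, where x(a,b) counts the neighbours of a in the colour
-- opposite to col(a,b). By AM–GM and the symmetry of the edge set, Σ x(a,b)·x(b,a) ≤ Σ x(a,b)²,
-- and at a vertex with r edges of one colour and s of the other the sum over b of x(a,b)² is
-- r·s² + s·r² = rs(r+s) ≤ d³/4. Hence n(n−1)t ≤ Σ_{u,v} #paths(u,v) ≤ n·d³/4.

open import Defs
open import Data.Bool.Base using (if_then_else_)
open import Data.Empty using (⊥-elim)
open import Data.Fin.Base using (Fin; zero; suc; opposite; punchIn)
open import Data.Fin.Patterns using (0F; 1F)
open import Data.Fin.Properties using (punchInᵢ≢i) renaming (_≟_ to _≟F_)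
open import Data.List.Base using (List; _++_; length; filter; cartesianProduct; tabulate; map)
open import Data.List.Properties using (filter-++; length-++; map-tabulate)
open import Data.Nat.Base using (ℕ; zero; suc; _+_; _*_; _∸_; _^_; _≤_; z≤n)
open import Data.Nat.Properties
open import Data.Nat.Tactic.RingSolver using (solve-∀)
open import Data.Sum.Base using ([_,_]′)
open import Data.Product.Base using (_×_; _,_; map₂)
open import Function.Base using (_∘_; id)
open import Relation.Binary.PropositionalEquality
  using (_≡_; _≢_; refl; sym; trans; cong; cong₂; subst; subst₂; module ≡-Reasoning)
open import Relation.Nullary.Decidable using (Dec; does; yes; no; _×-dec_; ¬?)
open import Algebra.Properties.Semiring.Sum +-*-semiring
  using (sum; sum-syntax; sum-cong-≗; ∑-distrib-+; ∑-comm; sum-remove; *-distribˡ-sum; *-distribʳ-sum)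

𝟙 : {P : Set} → Dec P → ℕ
𝟙 p = if does p then 1 else 0

𝟙-mono : {P Q : Set} → (P → Q) → (p : Dec P) (q : Dec Q) → 𝟙 p ≤ 𝟙 q
𝟙-mono P⇒Q (no _)  q       = z≤n
𝟙-mono P⇒Q (yes _) (yes _) = ≤-refl
𝟙-mono P⇒Q (yes p) (no ¬q) = ⊥-elim (¬q (P⇒Q p))

𝟙-cong : {P Q : Set} → (P → Q) → (Q → P) → (p : Dec P) (q : Dec Q) → 𝟙 p ≡ 𝟙 q
𝟙-cong P⇒Q Q⇒P p q = ≤-antisym (𝟙-mono P⇒Q p q) (𝟙-mono Q⇒P q p)

𝟙-× : {P Q : Set} (p : Dec P) (q : Dec Q) → 𝟙 (p ×-dec q) ≡ 𝟙 p * 𝟙 q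
𝟙-× (yes _) (yes _) = refl
𝟙-× (yes _) (no _)  = refl
𝟙-× (no _)  q       = refl

𝟙-split-Fin2 : {P : Set} (p : Dec P) (x : Fin 2) (f : Fin 2 → ℕ) →
  𝟙 p * f x ≡ 𝟙 (p ×-dec x ≟F 0F) * f 0F + 𝟙 (p ×-dec x ≟F 1F) * f 1F
𝟙-split-Fin2 (yes _) 0F f = sym (+-identityʳ _)
𝟙-split-Fin2 (yes _) 1F f = refl
𝟙-split-Fin2 (no _)  x  f = refl

≢⇒≡opposite : {x y : Fin 2} → x ≢ y → x ≡ opposite y
≢⇒≡opposite {0F} {0F} x≢y = ⊥-elim (x≢y refl)
≢⇒≡opposite {0F} {1F} _   = refl
≢⇒≡opposite {1F} {0F} _   = refl
≢⇒≡opposite {1F} {1F} x≢y = ⊥-elim (x≢y refl)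

≡opposite⇒≢ : {x y : Fin 2} → x ≡ opposite y → x ≢ y
≡opposite⇒≢ {0F} {0F} ()
≡opposite⇒≢ {0F} {1F} _ ()
≡opposite⇒≢ {1F} {0F} _ ()
≡opposite⇒≢ {1F} {1F} ()

length-filter-tabulate : {A : Set} {P : A → Set} (P? : ∀ x → Dec (P x)) {n : ℕ} (f : Fin n → A) →
  length (filter P? (tabulate f)) ≡ ∑[ i < n ] 𝟙 (P? (f i))
length-filter-tabulate P? {zero}  f = refl
length-filter-tabulate P? {suc n} f with P? (f zero)
... | yes _ = cong suc (length-filter-tabulate P? (f ∘ suc))
... | no _  = length-filter-tabulate P? (f ∘ suc)

length-filter-cartesianProduct : {A B : Set} {P : A × B → Set} (P? : ∀ x → Dec (P x))
  {m n : ℕ} (f : Fin m → A) (g : Fin n → B) →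
  length (filter P? (cartesianProduct (tabulate f) (tabulate g))) ≡
  ∑[ i < m ] ∑[ j < n ] 𝟙 (P? (f i , g j))
length-filter-cartesianProduct P? {zero}  f g = refl
length-filter-cartesianProduct {A} {B} P? {suc m} {n} f g = begin
  length (filter P? (row ++ rows))                  ≡⟨ cong length (filter-++ P? row rows) ⟩
  length (filter P? row ++ filter P? rows)          ≡⟨ length-++ (filter P? row) ⟩
  length (filter P? row) + length (filter P? rows)
    ≡⟨ cong₂ _+_ (cong (length ∘ filter P?) (map-tabulate g (f zero ,_)))
                 (length-filter-cartesianProduct P? (f ∘ suc) g) ⟩
  length (filter P? (tabulate ((f zero ,_) ∘ g))) + rest
    ≡⟨ cong (_+ rest) (length-filter-tabulate P? ((f zero ,_) ∘ g)) ⟩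
  ∑[ j < n ] 𝟙 (P? (f zero , g j)) + rest          ∎
  where
  open ≡-Reasoning
  row rows : List (A × B)
  row  = map (f zero ,_) (tabulate g)
  rows = cartesianProduct (tabulate (f ∘ suc)) (tabulate g)
  rest : ℕ
  rest = ∑[ i < m ] ∑[ j < n ] 𝟙 (P? (f (suc i) , g j))

∑-mono-≤ : ∀ {n} {f g : Fin n → ℕ} → (∀ i → f i ≤ g i) → sum f ≤ sum g
∑-mono-≤ {zero}  f≤g = z≤n
∑-mono-≤ {suc n} f≤g = +-mono-≤ (f≤g zero) (∑-mono-≤ (f≤g ∘ suc))

∑-const : ∀ n k → ∑[ i < n ] k ≡ n * k
∑-const zero    k = refl
∑-const (suc n) k = cong (k +_) (∑-const n k)

∑-lower-except : ∀ {m t} (f : Fin (suc m) → ℕ) (u : Fin (suc m)) →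
  (∀ v → u ≢ v → t ≤ f v) → m * t ≤ sum f
∑-lower-except {m} {t} f u t≤f = begin
  m * t                       ≡⟨ ∑-const m t ⟨
  ∑[ i < m ] t                ≤⟨ ∑-mono-≤ (λ i → t≤f (punchIn u i) (punchInᵢ≢i u i ∘ sym)) ⟩
  sum (f ∘ punchIn u)         ≤⟨ m≤n+m _ (f u) ⟩
  f u + sum (f ∘ punchIn u)   ≡⟨ sum-remove f ⟨
  sum f                       ∎
  where open ≤-Reasoning

∑∑-product : ∀ {m n} (f : Fin m → ℕ) (g : Fin n → ℕ) →
  ∑[ i < m ] ∑[ j < n ] (f i * g j) ≡ sum f * sum g
∑∑-product {m} {n} f g = begin
  ∑[ i < m ] ∑[ j < n ] (f i * g j)  ≡⟨ sum-cong-≗ (λ i → *-distribˡ-sum (f i) g) ⟨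
  ∑[ i < m ] (f i * sum g)           ≡⟨ *-distribʳ-sum (sum g) f ⟨
  sum f * sum g                      ∎
  where open ≡-Reasoning

∑⁴-reorder : ∀ {m n k l} (F : Fin m → Fin n → Fin k → Fin l → ℕ) →
  ∑[ u < m ] ∑[ v < n ] ∑[ a < k ] ∑[ b < l ] F u v a b ≡
  ∑[ a < k ] ∑[ b < l ] ∑[ u < m ] ∑[ v < n ] F u v a b
∑⁴-reorder {m} {n} {k} {l} F = begin
  ∑[ u < m ] ∑[ v < n ] ∑[ a < k ] ∑[ b < l ] F u v a b
    ≡⟨ sum-cong-≗ (λ u → ∑-comm (λ v a → ∑[ b < l ] F u v a b)) ⟩
  ∑[ u < m ] ∑[ a < k ] ∑[ v < n ] ∑[ b < l ] F u v a b
    ≡⟨ sum-cong-≗ (λ u → sum-cong-≗ (λ a → ∑-comm (λ v b → F u v a b))) ⟩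
  ∑[ u < m ] ∑[ a < k ] ∑[ b < l ] ∑[ v < n ] F u v a b
    ≡⟨ ∑-comm (λ u a → ∑[ b < l ] ∑[ v < n ] F u v a b) ⟩
  ∑[ a < k ] ∑[ u < m ] ∑[ b < l ] ∑[ v < n ] F u v a b
    ≡⟨ sum-cong-≗ (λ a → ∑-comm (λ u b → ∑[ v < n ] F u v a b)) ⟩
  ∑[ a < k ] ∑[ b < l ] ∑[ u < m ] ∑[ v < n ] F u v a b  ∎
  where open ≡-Reasoning

2*[m*n]≤m*m+n*n : ∀ m n → 2 * (m * n) ≤ m * m + n * n
2*[m*n]≤m*m+n*n m n = [ ordered , swapped ]′ (≤-total m n)
  where
  gap : ∀ m k → m * m + (m + k) * (m + k) ≡ 2 * (m * (m + k)) + k * k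
  gap = solve-∀
  ordered : ∀ {m n} → m ≤ n → 2 * (m * n) ≤ m * m + n * n
  ordered {m} m≤n with k , refl ← m≤n⇒∃[o]m+o≡n m≤n =
    subst (2 * (m * (m + k)) ≤_) (sym (gap m k)) (m≤m+n _ (k * k))
  swapped : n ≤ m → 2 * (m * n) ≤ m * m + n * n
  swapped n≤m = subst₂ _≤_ (cong (2 *_) (*-comm n m)) (+-comm (n * n) (m * m)) (ordered n≤m)

4*[m*n]≤[m+n]*[m+n] : ∀ m n → 4 * (m * n) ≤ (m + n) * (m + n)
4*[m*n]≤[m+n]*[m+n] m n = begin
  4 * (m * n)                    ≡⟨ double (m * n) ⟩
  2 * (m * n) + 2 * (m * n)      ≤⟨ +-monoˡ-≤ _ (2*[m*n]≤m*m+n*n m n) ⟩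
  m * m + n * n + 2 * (m * n)    ≡⟨ square m n ⟨
  (m + n) * (m + n)              ∎
  where
  open ≤-Reasoning
  double : ∀ x → 4 * x ≡ 2 * x + 2 * x
  double = solve-∀
  square : ∀ m n → (m + n) * (m + n) ≡ m * m + n * n + 2 * (m * n)
  square = solve-∀

4*[m*n²+n*m²]≤[m+n]³ : ∀ m n → 4 * (m * (n * n) + n * (m * m)) ≤ (m + n) ^ 3
4*[m*n²+n*m²]≤[m+n]³ m n = begin
  4 * (m * (n * n) + n * (m * m))   ≡⟨ factor m n ⟩
  4 * (m * n) * (m + n)             ≤⟨ *-monoˡ-≤ (m + n) (4*[m*n]≤[m+n]*[m+n] m n) ⟩
  (m + n) * (m + n) * (m + n)       ≡⟨ cube m n ⟩
  (m + n) ^ 3                       ∎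
  where
  open ≤-Reasoning
  factor : ∀ m n → 4 * (m * (n * n) + n * (m * m)) ≡ 4 * (m * n) * (m + n)
  factor = solve-∀
  cube : ∀ m n → (m + n) * (m + n) * (m + n) ≡ (m + n) * ((m + n) * ((m + n) * 1))
  cube = solve-∀

∑∑-weighted-amgm : ∀ {n} (w x : Fin n → Fin n → ℕ) → (∀ a b → w a b ≡ w b a) →
  ∑[ a < n ] ∑[ b < n ] (w a b * (x a b * x b a)) ≤ ∑[ a < n ] ∑[ b < n ] (w a b * (x a b * x a b))
∑∑-weighted-amgm {n} w x w-sym = *-cancelˡ-≤ 2 (begin
  2 * ∑[ a < n ] ∑[ b < n ] mixed a b
    ≡⟨ *-distribˡ-sum 2 (λ a → ∑[ b < n ] mixed a b) ⟩
  ∑[ a < n ] (2 * ∑[ b < n ] mixed a b)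
    ≡⟨ sum-cong-≗ (λ a → *-distribˡ-sum 2 (mixed a)) ⟩
  ∑[ a < n ] ∑[ b < n ] (2 * mixed a b)
    ≤⟨ ∑-mono-≤ (λ a → ∑-mono-≤ (λ b → pointwise (w a b) (x a b) (x b a))) ⟩
  ∑[ a < n ] ∑[ b < n ] (square a b + squareᵀ a b)
    ≡⟨ sum-cong-≗ (λ a → ∑-distrib-+ (square a) (squareᵀ a)) ⟩
  ∑[ a < n ] (∑[ b < n ] square a b + ∑[ b < n ] squareᵀ a b)
    ≡⟨ ∑-distrib-+ (λ a → ∑[ b < n ] square a b) (λ a → ∑[ b < n ] squareᵀ a b) ⟩
  S + ∑[ a < n ] ∑[ b < n ] squareᵀ a b
    ≡⟨ cong (S +_) transposed ⟩
  S + S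
    ≡⟨ cong (S +_) (+-identityʳ S) ⟨
  2 * S ∎)
  where
  open ≤-Reasoning
  mixed square squareᵀ : Fin n → Fin n → ℕ
  mixed   a b = w a b * (x a b * x b a)
  square  a b = w a b * (x a b * x a b)
  squareᵀ a b = w a b * (x b a * x b a)
  S : ℕ
  S = ∑[ a < n ] ∑[ b < n ] square a b
  pointwise : ∀ k y z → 2 * (k * (y * z)) ≤ k * (y * y) + k * (z * z)
  pointwise k y z = begin
    2 * (k * (y * z))         ≡⟨ left-comm 2 k (y * z) ⟩
    k * (2 * (y * z))         ≤⟨ *-monoʳ-≤ k (2*[m*n]≤m*m+n*n y z) ⟩
    k * (y * y + z * z)       ≡⟨ *-distribˡ-+ k _ _ ⟩
    k * (y * y) + k * (z * z) ∎
    where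
    left-comm : ∀ a b c → a * (b * c) ≡ b * (a * c)
    left-comm = solve-∀
  transposed : ∑[ a < n ] ∑[ b < n ] squareᵀ a b ≡ S
  transposed = trans (∑-comm squareᵀ)
    (sum-cong-≗ (λ b → sum-cong-≗ (λ a → cong (_* (x b a * x b a)) (w-sym a b))))

module TwoColouredAlternatingPaths {n : ℕ} (G : SimpleGraph n) (c : EdgeColouring G 2) where

  edge : Fin n → Fin n → ℕ
  edge a b = 𝟙 (adj? G a b)

  edge-sym : ∀ a b → edge a b ≡ edge b a
  edge-sym a b = 𝟙-cong (symm G) (symm G) (adj? G a b) (adj? G b a)

  Discordant : Fin n → Fin n → Fin n → Set
  Discordant a b u = Adj G a u × col c a u ≢ col c a b

  discordant? : ∀ a b u → Dec (Discordant a b u)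
  discordant? a b u = adj? G a u ×-dec ¬? (col c a u ≟F col c a b)

  discordantDegree : Fin n → Fin n → ℕ
  discordantDegree a b = ∑[ u < n ] 𝟙 (discordant? a b u)

  coloured? : ∀ a i u → Dec (Adj G a u × col c a u ≡ i)
  coloured? a i u = adj? G a u ×-dec col c a u ≟F i

  colourDegree : Fin n → Fin 2 → ℕ
  colourDegree a i = ∑[ u < n ] 𝟙 (coloured? a i u)

  discordantSquares : Fin n → ℕ
  discordantSquares a = ∑[ b < n ] (edge a b * (discordantDegree a b * discordantDegree a b))

  numAltPaths3≡∑∑ : ∀ u v → numAltPaths3 G c u v ≡ ∑[ a < n ] ∑[ b < n ] 𝟙 (altPath3? G c u v (a , b))
  numAltPaths3≡∑∑ u v = length-filter-cartesianProduct (altPath3? G c u v) id id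

  altPath3⇒discordant : ∀ {u v a b} → AltPath3 G c u v (a , b) →
    Adj G a b × Discordant a b u × Discordant b a v
  altPath3⇒discordant {u} {v} {a} {b} (_ , _ , _ , _ , _ , _ , ua , ab , bv , ua≢ab , ab≢bv) =
    ab , (symm G ua , ua≢ab ∘ trans (colSym c u a)) , (bv , ab≢bv ∘ trans (colSym c a b) ∘ sym)

  altPaths-through≤ : ∀ a b →
    ∑[ u < n ] ∑[ v < n ] 𝟙 (altPath3? G c u v (a , b)) ≤
    edge a b * (discordantDegree a b * discordantDegree b a)
  altPaths-through≤ a b = begin
    ∑[ u < n ] ∑[ v < n ] 𝟙 (altPath3? G c u v (a , b))
      ≤⟨ ∑-mono-≤ (λ u → ∑-mono-≤ (λ v → path≤ u v)) ⟩
    ∑[ u < n ] ∑[ v < n ] (edge a b * (from-a u * into-b v))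
      ≡⟨ sum-cong-≗ (λ u → *-distribˡ-sum (edge a b) (λ v → from-a u * into-b v)) ⟨
    ∑[ u < n ] (edge a b * ∑[ v < n ] (from-a u * into-b v))
      ≡⟨ *-distribˡ-sum (edge a b) (λ u → ∑[ v < n ] (from-a u * into-b v)) ⟨
    edge a b * ∑[ u < n ] ∑[ v < n ] (from-a u * into-b v)
      ≡⟨ cong (edge a b *_) (∑∑-product from-a into-b) ⟩
    edge a b * (discordantDegree a b * discordantDegree b a) ∎
    where
    open ≤-Reasoning
    from-a into-b : Fin n → ℕ
    from-a u = 𝟙 (discordant? a b u)
    into-b v = 𝟙 (discordant? b a v)
    path≤ : ∀ u v → 𝟙 (altPath3? G c u v (a , b)) ≤ edge a b * (from-a u * into-b v)
    path≤ u v = begin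
      𝟙 (altPath3? G c u v (a , b))
        ≤⟨ 𝟙-mono altPath3⇒discordant (altPath3? G c u v (a , b)) (adj? G a b ×-dec discordant-ends) ⟩
      𝟙 (adj? G a b ×-dec discordant-ends)
        ≡⟨ 𝟙-× (adj? G a b) discordant-ends ⟩
      edge a b * 𝟙 discordant-ends
        ≡⟨ cong (edge a b *_) (𝟙-× (discordant? a b u) (discordant? b a v)) ⟩
      edge a b * (from-a u * into-b v) ∎
      where
      discordant-ends : Dec (Discordant a b u × Discordant b a v)
      discordant-ends = discordant? a b u ×-dec discordant? b a v

  ∑∑-numAltPaths3≤ :
    ∑[ u < n ] ∑[ v < n ] numAltPaths3 G c u v ≤
    ∑[ a < n ] ∑[ b < n ] (edge a b * (discordantDegree a b * discordantDegree b a))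
  ∑∑-numAltPaths3≤ = begin
    ∑[ u < n ] ∑[ v < n ] numAltPaths3 G c u v
      ≡⟨ sum-cong-≗ (λ u → sum-cong-≗ (numAltPaths3≡∑∑ u)) ⟩
    ∑[ u < n ] ∑[ v < n ] ∑[ a < n ] ∑[ b < n ] 𝟙 (altPath3? G c u v (a , b))
      ≡⟨ ∑⁴-reorder (λ u v a b → 𝟙 (altPath3? G c u v (a , b))) ⟩
    ∑[ a < n ] ∑[ b < n ] ∑[ u < n ] ∑[ v < n ] 𝟙 (altPath3? G c u v (a , b))
      ≤⟨ ∑-mono-≤ (λ a → ∑-mono-≤ (altPaths-through≤ a)) ⟩
    ∑[ a < n ] ∑[ b < n ] (edge a b * (discordantDegree a b * discordantDegree b a)) ∎
    where open ≤-Reasoning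

  discordantDegree≡colourDegree : ∀ a b → discordantDegree a b ≡ colourDegree a (opposite (col c a b))
  discordantDegree≡colourDegree a b =
    sum-cong-≗ (λ u → 𝟙-cong (map₂ ≢⇒≡opposite) (map₂ ≡opposite⇒≢)
      (discordant? a b u) (coloured? a (opposite (col c a b)) u))

  degree≡∑colourDegree : ∀ a → degree G a ≡ colourDegree a 0F + colourDegree a 1F
  degree≡∑colourDegree a = begin
    degree G a
      ≡⟨ length-filter-tabulate (adj? G a) id ⟩
    ∑[ u < n ] 𝟙 (adj? G a u)
      ≡⟨ sum-cong-≗ split ⟩
    ∑[ u < n ] (𝟙 (coloured? a 0F u) + 𝟙 (coloured? a 1F u))
      ≡⟨ ∑-distrib-+ (𝟙 ∘ coloured? a 0F) (𝟙 ∘ coloured? a 1F) ⟩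
    colourDegree a 0F + colourDegree a 1F ∎
    where
    open ≡-Reasoning
    split : ∀ u → 𝟙 (adj? G a u) ≡ 𝟙 (coloured? a 0F u) + 𝟙 (coloured? a 1F u)
    split u = begin
      𝟙 (adj? G a u)
        ≡⟨ *-identityʳ (𝟙 (adj? G a u)) ⟨
      𝟙 (adj? G a u) * 1
        ≡⟨ 𝟙-split-Fin2 (adj? G a u) (col c a u) (λ _ → 1) ⟩
      𝟙 (coloured? a 0F u) * 1 + 𝟙 (coloured? a 1F u) * 1
        ≡⟨ cong₂ _+_ (*-identityʳ (𝟙 (coloured? a 0F u))) (*-identityʳ (𝟙 (coloured? a 1F u))) ⟩
      𝟙 (coloured? a 0F u) + 𝟙 (coloured? a 1F u) ∎

  discordantSquares≡ : ∀ a →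
    discordantSquares a ≡
    colourDegree a 0F * (colourDegree a 1F * colourDegree a 1F) +
    colourDegree a 1F * (colourDegree a 0F * colourDegree a 0F)
  discordantSquares≡ a = begin
    discordantSquares a
      ≡⟨ sum-cong-≗ (λ b → cong (λ k → edge a b * (k * k)) (discordantDegree≡colourDegree a b)) ⟩
    ∑[ b < n ] (edge a b * square (col c a b))
      ≡⟨ sum-cong-≗ (λ b → 𝟙-split-Fin2 (adj? G a b) (col c a b) square) ⟩
    ∑[ b < n ] (𝟙 (coloured? a 0F b) * square 0F + 𝟙 (coloured? a 1F b) * square 1F)
      ≡⟨ ∑-distrib-+ (λ b → 𝟙 (coloured? a 0F b) * square 0F) (λ b → 𝟙 (coloured? a 1F b) * square 1F) ⟩
    ∑[ b < n ] (𝟙 (coloured? a 0F b) * square 0F) + ∑[ b < n ] (𝟙 (coloured? a 1F b) * square 1F)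
      ≡⟨ cong₂ _+_ (*-distribʳ-sum (square 0F) (𝟙 ∘ coloured? a 0F))
                   (*-distribʳ-sum (square 1F) (𝟙 ∘ coloured? a 1F)) ⟨
    colourDegree a 0F * square 0F + colourDegree a 1F * square 1F ∎
    where
    open ≡-Reasoning
    square : Fin 2 → ℕ
    square i = colourDegree a (opposite i) * colourDegree a (opposite i)

  4*discordantSquares≤degree³ : ∀ a → 4 * discordantSquares a ≤ degree G a ^ 3
  4*discordantSquares≤degree³ a =
    subst₂ (λ s d → 4 * s ≤ d ^ 3) (sym (discordantSquares≡ a)) (sym (degree≡∑colourDegree a))
      (4*[m*n²+n*m²]≤[m+n]³ (colourDegree a 0F) (colourDegree a 1F))

  4*∑∑numAltPaths3≤n*d³ : ∀ {d} → Regular G d →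
    4 * ∑[ u < n ] ∑[ v < n ] numAltPaths3 G c u v ≤ n * d ^ 3
  4*∑∑numAltPaths3≤n*d³ {d} regular = begin
    4 * ∑[ u < n ] ∑[ v < n ] numAltPaths3 G c u v
      ≤⟨ *-monoʳ-≤ 4 (≤-trans ∑∑-numAltPaths3≤ (∑∑-weighted-amgm edge discordantDegree edge-sym)) ⟩
    4 * ∑[ a < n ] discordantSquares a
      ≡⟨ *-distribˡ-sum 4 discordantSquares ⟩
    ∑[ a < n ] (4 * discordantSquares a)
      ≤⟨ ∑-mono-≤ (λ a → subst (λ k → 4 * discordantSquares a ≤ k ^ 3) (regular a) (4*discordantSquares≤degree³ a)) ⟩
    ∑[ a < n ] (d ^ 3)
      ≡⟨ ∑-const n (d ^ 3) ⟩
    n * d ^ 3 ∎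
    where open ≤-Reasoning

proposition6p1 : (n d : ℕ) → 2 ≤ n → (G : SimpleGraph n) → Regular G d →
                 (t : ℕ) → Achievable23 G 2 t → 4 * (n ∸ 1) * t ≤ d ^ 3
proposition6p1 zero    d _ _ _       t _               = z≤n
proposition6p1 (suc m) d _ G regular t (c , t≤paths) = *-cancelʳ-≤ (4 * m * t) (d ^ 3) (suc m) (begin
  4 * m * t * suc m
    ≡⟨ rearrange m t ⟩
  4 * (suc m * (m * t))
    ≡⟨ cong (4 *_) (∑-const (suc m) (m * t)) ⟨
  4 * ∑[ u < suc m ] (m * t)
    ≤⟨ *-monoʳ-≤ 4 (∑-mono-≤ pathsFrom) ⟩
  4 * ∑[ u < suc m ] ∑[ v < suc m ] numAltPaths3 G c u v
    ≤⟨ 4*∑∑numAltPaths3≤n*d³ regular ⟩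
  suc m * d ^ 3
    ≡⟨ *-comm (suc m) (d ^ 3) ⟩
  d ^ 3 * suc m ∎)
  where
  open ≤-Reasoning
  open TwoColouredAlternatingPaths G c
  pathsFrom : ∀ u → m * t ≤ ∑[ v < suc m ] numAltPaths3 G c u v
  pathsFrom u = ∑-lower-except (numAltPaths3 G c u) u (t≤paths u)
  rearrange : ∀ m t → 4 * m * t * suc m ≡ 4 * (suc m * (m * t))
  rearrange = solve-∀
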